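{- For any graphs $G$ and $H$, $\alpha^*(G|H)\ge \dfrac{\alpha^*(G)}{\alpha^*(H)}$ and $\alpha^*(G\boxtimes H|H)=\alpha^*(G)$.
   Context: All graphs are finite, simple, undirected; $\boxtimes$ is the strong product; $\alpha^*(G|H)=\sup_W\frac{\alpha(G\boxtimes W)}{\alpha(H\boxtimes W)}$ over all graphs $W$. The fractional independence number $\alpha^*(G)$ is the maximum of $\sum_v w_v$ over $w_v\ge0$ with $\sum_{v\in\mathcal S}w_v\le 1$ for every clique $\mathcal S$ of $G$. -}

module Defs where

open import Data.Nat as ℕ using (ℕ; zero; suc; _≤_)
open import Data.Fin using (Fin; zero; suc; remQuot; _≟_)
open import Data.Fin.Subset using (Subset; ∣_∣)
open import Data.Vec using (lookup)
open import Data.Bool using (Bool; true; false; _∧_; _∨_; not; if_then_else_)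
open import Data.Integer using (+_)
open import Data.Rational using (ℚ; 0ℚ; 1ℚ; _/_) renaming (_+_ to _+ℚ_; _≤_ to _≤ℚ_)
open import Data.Product using (Σ; _×_; proj₁; proj₂)
open import Relation.Nullary using (¬_; does)
open import Relation.Binary.PropositionalEquality using (_≡_; _≢_)

record Graph : Set where
  constructor graph
  field
    n   : ℕ
    adj : Fin n → Fin n → Bool
open Graph public

record IsSimple (G : Graph) : Set where
  field
    symm    : ∀ u v → adj G u v ≡ adj G v u
    irrefl  : ∀ v → adj G v v ≡ false

NonEmpty : Graph → Set
NonEmpty G = Fin (n G)

-- Strong product; vertex set Fin (n G * n H) ≅ Fin (n G) × Fin (n H) via remQuot.
-- (u,v) ~ (u',v') iff (u,v) ≠ (u',v'), (u = u' or u ~ u'), (v = v' or v ~ v').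
_⊠_ : Graph → Graph → Graph
G ⊠ H = graph (n G ℕ.* n H) A
  where
  A : Fin (n G ℕ.* n H) → Fin (n G ℕ.* n H) → Bool
  A x y =
    let a = proj₁ (remQuot {n G} (n H) x) ; b = proj₂ (remQuot {n G} (n H) x)
        c = proj₁ (remQuot {n G} (n H) y) ; d = proj₂ (remQuot {n G} (n H) y)
    in not (does (x ≟ y)) ∧ (does (a ≟ c) ∨ adj G a c) ∧ (does (b ≟ d) ∨ adj H b d)

_∈ₛ_ : ∀ {m} → Fin m → Subset m → Set
v ∈ₛ S = lookup S v ≡ true

IsIndependent : (G : Graph) → Subset (n G) → Set
IsIndependent G S = ∀ u v → u ∈ₛ S → v ∈ₛ S → adj G u v ≡ false

IsClique : (G : Graph) → Subset (n G) → Set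
IsClique G S = ∀ u v → u ∈ₛ S → v ∈ₛ S → u ≢ v → adj G u v ≡ true

IsIndepNumber : Graph → ℕ → Set
IsIndepNumber G k =
  Σ (Subset (n G)) (λ S → IsIndependent G S × ∣ S ∣ ≡ k)
  × (∀ S → IsIndependent G S → ∣ S ∣ ≤ k)

∑ : ∀ {m} → (Fin m → ℚ) → ℚ
∑ {zero}  f = 0ℚ
∑ {suc m} f = f zero +ℚ ∑ (λ i → f (suc i))

∑over : ∀ {m} → Subset m → (Fin m → ℚ) → ℚ
∑over S w = ∑ (λ v → if lookup S v then w v else 0ℚ)

IsFracIndep : (G : Graph) → (Fin (n G) → ℚ) → Set
IsFracIndep G w = (∀ v → 0ℚ ≤ℚ w v) × (∀ S → IsClique G S → ∑over S w ≤ℚ 1ℚ)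

IsFracIndepNumber : Graph → ℚ → Set
IsFracIndepNumber G r =
  Σ (Fin (n G) → ℚ) (λ w → IsFracIndep G w × ∑ w ≡ r)
  × (∀ w → IsFracIndep G w → ∑ w ≤ℚ r)

ℕ→ℚ : ℕ → ℚ
ℕ→ℚ k = + k / 1

-- The upper bound is the inequality α(Z) ≤ α*(G)·α(K) for every graph Z that projects onto
-- G ⊠ K in the sense that vertices with adjacent-or-equal images in both factors are adjacent
-- (Z = (G ⊠ H) ⊠ W, K = H ⊠ W). Counting an independent set S of Z along its G-coordinate gives
-- integer weights on G: the points of S above a clique of G project injectively onto an
-- independent set of K, so every clique receives weight at most α(K), and dividing by α(K)
-- yields a feasible fractional weighting of G of total |S|/α(K).
--
-- For the lower bounds, clear the denominators of an optimal fractional weighting of X to get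
-- integer weights p with clique sums at most D and total α*(X)·D, and let W be the complement of
-- X with each vertex v blown up into p(v) nonadjacent copies. An independent set of W lies over
-- a clique of X, so α(W) ≤ D and hence α(H ⊠ W) ≤ α*(H)·D, while the copies paired with their
-- owners form an independent set of X ⊠ W of size α*(X)·D. With X = G this gives the ratio
-- α*(G)/α*(H); with X = G ⊠ H and the product of the optimal weightings it gives α*(G).
module Submission where

open import Defs
open import Data.Bool using (Bool; true; false; _∧_; _∨_; not; if_then_else_)
  renaming (_≟_ to _≟ᵇ_)
open import Data.Bool.Properties
  using (not-injective; ∧-conicalˡ; ∧-conicalʳ; ∨-conicalʳ; ∧-identityʳ; ∧-zeroʳ; ∨-zeroʳ)
open import Data.Empty using (⊥-elim)
open import Data.Fin using (Fin; zero; suc; _↑ˡ_; _↑ʳ_; splitAt; combine; remQuot; _≟_; fromℕ<)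
open import Data.Fin.Properties
  using (splitAt-↑ˡ; splitAt-↑ʳ; suc-injective; any?; all?; remQuot-combine; combine-injectiveˡ; combine-injectiveʳ)
open import Data.Fin.Subset using (Subset; ∣_∣; ⁅_⁆) renaming (⊥ to ∅)
open import Data.Fin.Subset.Properties using (∣p∣≤n; ∣⁅x⁆∣≡1; x∈⁅y⁆⇒x≡y)
open import Data.Nat as ℕ using (ℕ; zero; suc; z≤n; s≤s)
import Data.Nat.Properties as ℕP
open import Algebra.Properties.Semiring.Sum ℕP.+-*-semiring
  using (sum; sum-cong-≗; sum-replicate-zero; ∑-comm; *-distribˡ-sum; *-distribʳ-sum)
import Data.Integer as ℤ
import Data.Integer.Properties as ℤP
import Data.Nat.Coprimality as Coprime
open import Data.Rational
  using (ℚ; mkℚ; 0ℚ; 1ℚ; *≤*; *<*; toℚᵘ; 1/_; Positive; NonNegative; NonZero; positive; nonNegative)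
import Data.Rational.Properties as ℚP
open import Algebra.Solver.CommutativeMonoid ℚP.*-1-commutativeMonoid using (solve; _⊕_; _⊜_)
import Data.Rational.Unnormalised as ℚᵘ
import Data.Rational.Unnormalised.Properties as ℚᵘP
open import Data.Product using (Σ; ∃; _×_; _,_; proj₁; proj₂)
open import Data.Sum using (_⊎_; inj₁; inj₂; [_,_]′)
open import Data.Vec using ([]; _∷_; lookup; tabulate)
open import Data.Vec.Properties using (lookup∘tabulate; lookup-replicate; lookup⇒[]=)
open import Function using (_∘_; case_of_)
open import Function.Bundles using (mk⇔)
open import Relation.Nullary using (¬_; Dec; yes; no; does)
open import Relation.Nullary.Decidable using (dec-true; dec-false; does-⇔; _×-dec_; _→-dec_)
open import Relation.Unary using (Decidable)
open import Relation.Binary.PropositionalEquality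

does-true⇒ : ∀ {p} {P : Set p} (P? : Dec P) → does P? ≡ true → P
does-true⇒ (yes p) _ = p

∧-true⁻ : ∀ {a b} → a ∧ b ≡ true → a ≡ true × b ≡ true
∧-true⁻ e = ∧-conicalˡ _ _ e , ∧-conicalʳ _ _ e

∧-true⁺ : ∀ {a b} → a ≡ true → b ≡ true → a ∧ b ≡ true
∧-true⁺ refl refl = refl

_==_ : ∀ {m} → Fin m → Fin m → Bool
i == j = does (i ≟ j)

==-refl : ∀ {m} (i : Fin m) → (i == i) ≡ true
==-refl i = dec-true (i ≟ i) refl

==⇒≡ : ∀ {m} {i j : Fin m} → (i == j) ≡ true → i ≡ j
==⇒≡ {i = i} {j} = does-true⇒ (i ≟ j)

≢⇒==-false : ∀ {m} {i j : Fin m} → i ≢ j → (i == j) ≡ false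
≢⇒==-false {i = i} {j} = dec-false (i ≟ j)

==-sym : ∀ {m} (i j : Fin m) → (i == j) ≡ (j == i)
==-sym i j = does-⇔ (mk⇔ sym sym) (i ≟ j) (j ≟ i)

-- Finite sums, counting and fibres

module _ where
  open import Data.Nat using (_+_; _*_; _≤_)

  sum-mono : ∀ {m} {f g : Fin m → ℕ} → (∀ i → f i ≤ g i) → sum f ≤ sum g
  sum-mono {zero}  _   = z≤n
  sum-mono {suc m} f≤g = ℕP.+-mono-≤ (f≤g zero) (sum-mono (λ i → f≤g (suc i)))

  sum-zero : ∀ {m} {f : Fin m → ℕ} → (∀ i → f i ≡ 0) → sum f ≡ 0
  sum-zero {m} f≗0 = trans (sum-cong-≗ f≗0) (sum-replicate-zero m)

  sum-if : ∀ {m} (b : Bool) (f : Fin m → ℕ) →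
           (if b then sum f else 0) ≡ sum (λ i → if b then f i else 0)
  sum-if true  f = refl
  sum-if {m} false f = sym (sum-zero {m} λ _ → refl)

  sum-↑ : ∀ a b (f : Fin (a + b) → ℕ) →
          sum f ≡ sum (λ i → f (i ↑ˡ b)) + sum (λ j → f (a ↑ʳ j))
  sum-↑ zero    b f = refl
  sum-↑ (suc a) b f =
    trans (cong (f zero +_) (sum-↑ a b (λ i → f (suc i)))) (sym (ℕP.+-assoc (f zero) _ _))

  sum-combine : ∀ m k (f : Fin (m * k) → ℕ) →
                sum f ≡ sum {m} (λ i → sum {k} (λ j → f (combine i j)))
  sum-combine zero    k f = refl
  sum-combine (suc m) k f =
    trans (sum-↑ k (m * k) f) (cong (sum {k} (λ j → f (j ↑ˡ (m * k))) +_) (sum-combine m k (λ x → f (k ↑ʳ x))))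

  sum-indicator : ∀ {m} (x : Fin m) (c : ℕ) → sum (λ i → if x == i then c else 0) ≡ c
  sum-indicator {suc m} zero    c = trans (cong (c +_) (sum-zero {m} λ _ → refl)) (ℕP.+-identityʳ c)
  sum-indicator {suc m} (suc x) c = sum-indicator x c

  count : ∀ {m} → (Fin m → Bool) → ℕ
  count P = sum (λ i → if P i then 1 else 0)

  sumOver : ∀ {m} → Subset m → (Fin m → ℕ) → ℕ
  sumOver S p = sum (λ v → if lookup S v then p v else 0)

  count-true : ∀ m → count {m} (λ _ → true) ≡ m
  count-true zero    = refl
  count-true (suc m) = cong suc (count-true m)

  ∣∣≡count : ∀ {m} (S : Subset m) → ∣ S ∣ ≡ count (lookup S)
  ∣∣≡count []          = refl
  ∣∣≡count (true ∷ S)  = cong suc (∣∣≡count S)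
  ∣∣≡count (false ∷ S) = ∣∣≡count S

  count-≤1 : ∀ {m} (P : Fin m → Bool) → (∀ i j → P i ≡ true → P j ≡ true → i ≡ j) → count P ≤ 1
  count-≤1 {zero}  P unique = z≤n
  count-≤1 {suc m} P unique with P zero in P0
  ... | true  = ℕP.≤-reflexive (cong suc (sum-zero rest-false))
    where
    rest-false : ∀ i → (if P (suc i) then 1 else 0) ≡ 0
    rest-false i with P (suc i) in Pi
    ... | true  with () ← unique zero (suc i) P0 Pi
    ... | false = refl
  ... | false = count-≤1 (λ i → P (suc i)) λ i j Pi Pj → suc-injective (unique (suc i) (suc j) Pi Pj)

  module _ {k m} (A : Fin k → Bool) (φ : Fin k → Fin m) where

    fibre : Fin m → ℕ
    fibre v = count (λ t → A t ∧ (φ t == v))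

    image : Subset m
    image = tabulate λ v → does (any? λ t → (A t ≟ᵇ true) ×-dec (φ t ≟ v))

    image-sound : ∀ {v} → v ∈ₛ image → ∃ λ t → A t ≡ true × φ t ≡ v
    image-sound {v} v∈ = does-true⇒ (any? _) (trans (sym (lookup∘tabulate _ v)) v∈)

    image-complete : ∀ {t v} → A t ≡ true → φ t ≡ v → v ∈ₛ image
    image-complete {t} {v} At φt≡v = trans (lookup∘tabulate _ v) (dec-true (any? _) (t , At , φt≡v))

    sum-fibres : (C : Fin m → Bool) →
                 sum (λ v → if C v then fibre v else 0) ≡ count (λ t → A t ∧ C (φ t))
    sum-fibres C = begin
      sum (λ v → if C v then fibre v else 0)
        ≡⟨ sum-cong-≗ (λ v → sum-if (C v) (λ t → if A t ∧ (φ t == v) then 1 else 0)) ⟩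
      sum (λ v → sum (λ t → if C v then (if A t ∧ (φ t == v) then 1 else 0) else 0))
        ≡⟨ ∑-comm (λ v t → if C v then (if A t ∧ (φ t == v) then 1 else 0) else 0) ⟩
      sum (λ t → sum (λ v → if C v then (if A t ∧ (φ t == v) then 1 else 0) else 0))
        ≡⟨ sum-cong-≗ (λ t → sum-cong-≗ (exchange t)) ⟩
      sum (λ t → sum (λ v → if φ t == v then (if A t ∧ C (φ t) then 1 else 0) else 0))
        ≡⟨ sum-cong-≗ (λ t → sum-indicator (φ t) _) ⟩
      count (λ t → A t ∧ C (φ t)) ∎
      where
      open ≡-Reasoning
      exchange : ∀ t v → (if C v then (if A t ∧ (φ t == v) then 1 else 0) else 0)
                       ≡ (if φ t == v then (if A t ∧ C (φ t) then 1 else 0) else 0)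
      exchange t v with φ t ≟ v
      ... | yes refl = merge (A t) (C (φ t))
        where
        merge : ∀ a c → (if c then (if a ∧ true then 1 else 0) else 0) ≡ (if a ∧ c then 1 else 0)
        merge true  true  = refl
        merge true  false = refl
        merge false true  = refl
        merge false false = refl
      ... | no _ = vanish (A t) (C v)
        where
        vanish : ∀ a c → (if c then (if a ∧ false then 1 else 0) else 0) ≡ 0
        vanish a true  rewrite ∧-zeroʳ a = refl
        vanish a false = refl

    sum-fibre : sum fibre ≡ count A
    sum-fibre = trans (sum-fibres (λ _ → true))
                      (sum-cong-≗ λ t → cong (λ b → if b then 1 else 0) (∧-identityʳ (A t)))

    fibre-outside-image : ∀ v → lookup image v ≡ false → fibre v ≡ 0
    fibre-outside-image v v∉ = sum-zero term
      where
      term : ∀ t → (if A t ∧ (φ t == v) then 1 else 0) ≡ 0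
      term t with A t ∧ (φ t == v) in e
      ... | false = refl
      ... | true with () ← trans (sym (image-complete (proj₁ (∧-true⁻ e)) (==⇒≡ (proj₂ (∧-true⁻ e))))) v∉

    count-≤-image : (b : Fin m → ℕ) → (∀ v → fibre v ≤ b v) → count A ≤ sumOver image b
    count-≤-image b fibre≤b = begin
      count A         ≡⟨ sum-fibre ⟨
      sum fibre       ≤⟨ sum-mono bound ⟩
      sumOver image b ∎
      where
      open ℕP.≤-Reasoning
      bound : ∀ v → fibre v ≤ (if lookup image v then b v else 0)
      bound v with lookup image v in e
      ... | true  = fibre≤b v
      ... | false = ℕP.≤-reflexive (fibre-outside-image v e)

    count-≤-count-image : (∀ t t' → A t ≡ true → A t' ≡ true → φ t ≡ φ t' → t ≡ t') →
                          count A ≤ ∣ image ∣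
    count-≤-count-image injective =
      ℕP.≤-trans (count-≤-image (λ _ → 1) fibre≤1) (ℕP.≤-reflexive (sym (∣∣≡count image)))
      where
      fibre≤1 : ∀ v → fibre v ≤ 1
      fibre≤1 v = count-≤1 (λ t → A t ∧ (φ t == v)) λ t t' e e' →
        injective t t' (proj₁ (∧-true⁻ e)) (proj₁ (∧-true⁻ e'))
                       (trans (==⇒≡ (proj₂ (∧-true⁻ e))) (sym (==⇒≡ (proj₂ (∧-true⁻ e')))))

  owner : ∀ {m} (p : Fin m → ℕ) → Fin (sum p) → Fin m
  owner {suc m} p t = [ (λ _ → zero) , (λ t′ → suc (owner (λ i → p (suc i)) t′)) ]′ (splitAt (p zero) t)

  fibre-owner : ∀ {m} (p : Fin m → ℕ) (v : Fin m) → fibre (λ _ → true) (owner p) v ≡ p v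
  fibre-owner {suc m} p v = begin
    fibre (λ _ → true) (owner p) v
      ≡⟨ sum-↑ (p zero) (sum p′) _ ⟩
    sum {p zero} (λ i → hits (owner p (i ↑ˡ sum p′))) + sum (λ j → hits (owner p (p zero ↑ʳ j)))
      ≡⟨ cong₂ _+_ (sum-cong-≗ λ i → cong (λ s → hits (ownerOf s)) (splitAt-↑ˡ (p zero) i (sum p′)))
                   (sum-cong-≗ λ j → cong (λ s → hits (ownerOf s)) (splitAt-↑ʳ (p zero) (sum p′) j)) ⟩
    sum {p zero} (λ _ → hits zero) + fibre (λ _ → true) (λ j → suc (owner p′ j)) v
      ≡⟨ blocks v ⟩
    p v ∎
    where
    open ≡-Reasoning
    p′ : Fin m → ℕ
    p′ i = p (suc i)
    hits : Fin (suc m) → ℕ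
    hits u = if u == v then 1 else 0
    ownerOf : Fin (p zero) ⊎ Fin (sum p′) → Fin (suc m)
    ownerOf = [ (λ _ → zero) , (λ t′ → suc (owner p′ t′)) ]′
    blocks : ∀ u → sum {p zero} (λ _ → if zero == u then 1 else 0)
                   + fibre (λ _ → true) (λ j → suc (owner p′ j)) u ≡ p u
    blocks zero    = trans (cong₂ _+_ (count-true (p zero)) (sum-zero {sum p′} λ _ → refl))
                           (ℕP.+-identityʳ _)
    blocks (suc u) = trans (cong (_+ fibre (λ _ → true) (owner p′) u) (sum-zero {p zero} λ _ → refl))
                           (fibre-owner p′ u)

-- A Boolean, so that adj (G ⊠ H) x y unfolds to not (x == y) ∧ adjOrEq G _ _ ∧ adjOrEq H _ _.
adjOrEq : (G : Graph) → Fin (n G) → Fin (n G) → Bool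
adjOrEq G u v = (u == v) ∨ adj G u v

≡⇒adjOrEq : ∀ G {u v} → u ≡ v → adjOrEq G u v ≡ true
≡⇒adjOrEq G {u} refl rewrite ==-refl u = refl

adj⇒adjOrEq : ∀ G {u v} → adj G u v ≡ true → adjOrEq G u v ≡ true
adj⇒adjOrEq G {u} {v} e rewrite e = ∨-zeroʳ (u == v)

adjOrEq⇒adj : ∀ G {u v} → u ≢ v → adjOrEq G u v ≡ true → adj G u v ≡ true
adjOrEq⇒adj G u≢v e rewrite ≢⇒==-false u≢v = e

adjOrEq-sym : ∀ {G} → IsSimple G → ∀ u v → adjOrEq G u v ≡ adjOrEq G v u
adjOrEq-sym sG u v = cong₂ _∨_ (==-sym u v) (IsSimple.symm sG u v)

clique⇒adjOrEq : ∀ {G} C {u v} → IsClique G C → u ∈ₛ C → v ∈ₛ C → adjOrEq G u v ≡ true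
clique⇒adjOrEq C {u} {v} isClique u∈ v∈ with u ≟ v
... | yes _   = refl
... | no  u≢v = isClique u v u∈ v∈ u≢v

module _ (G H : Graph) where

  ⊠-fst : Fin (n (G ⊠ H)) → Fin (n G)
  ⊠-fst z = proj₁ (remQuot {n G} (n H) z)

  ⊠-snd : Fin (n (G ⊠ H)) → Fin (n H)
  ⊠-snd z = proj₂ (remQuot {n G} (n H) z)

  ⊠-adj⁺ : ∀ {x y} → x ≢ y → adjOrEq G (⊠-fst x) (⊠-fst y) ≡ true →
           adjOrEq H (⊠-snd x) (⊠-snd y) ≡ true → adj (G ⊠ H) x y ≡ true
  ⊠-adj⁺ x≢y e₁ e₂ = ∧-true⁺ (cong not (≢⇒==-false x≢y)) (∧-true⁺ e₁ e₂)

  ⊠-adj⁻ : ∀ {x y} → adj (G ⊠ H) x y ≡ true →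
           adjOrEq G (⊠-fst x) (⊠-fst y) ≡ true × adjOrEq H (⊠-snd x) (⊠-snd y) ≡ true
  ⊠-adj⁻ {x} {y} e with x ≟ y
  ... | no _ = ∧-true⁻ e

  ⊠-fst-combine : ∀ g h → ⊠-fst (combine g h) ≡ g
  ⊠-fst-combine g h = cong proj₁ (remQuot-combine {n G} {n H} g h)

  ⊠-snd-combine : ∀ g h → ⊠-snd (combine g h) ≡ h
  ⊠-snd-combine g h = cong proj₂ (remQuot-combine {n G} {n H} g h)

  ⊠-adjOrEq⁺ : ∀ {x y} → adjOrEq G (⊠-fst x) (⊠-fst y) ≡ true →
               adjOrEq H (⊠-snd x) (⊠-snd y) ≡ true → adjOrEq (G ⊠ H) x y ≡ true
  ⊠-adjOrEq⁺ {x} {y} e₁ e₂ with x ≟ y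
  ... | yes _   = refl
  ... | no  _ = ∧-true⁺ e₁ e₂

  ⊠-adjOrEq-combine⁻ : ∀ {g g′ : Fin (n G)} {h h′ : Fin (n H)} →
                       adjOrEq (G ⊠ H) (combine g h) (combine g′ h′) ≡ true →
                       adjOrEq G g g′ ≡ true × adjOrEq H h h′ ≡ true
  ⊠-adjOrEq-combine⁻ {g} {g′} {h} {h′} e with combine g h ≟ combine g′ h′
  ... | yes same = ≡⇒adjOrEq G (combine-injectiveˡ g h g′ h′ same)
                 , ≡⇒adjOrEq H (combine-injectiveʳ g h g′ h′ same)
  ... | no  _    with ∧-true⁻ e
  ...   | e₁ , e₂ = subst₂ (λ u v → adjOrEq G u v ≡ true) (⊠-fst-combine g h) (⊠-fst-combine g′ h′) e₁
                      , subst₂ (λ u v → adjOrEq H u v ≡ true) (⊠-snd-combine g h) (⊠-snd-combine g′ h′) e₂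

  ⊠-irrefl : ∀ x → adj (G ⊠ H) x x ≡ false
  ⊠-irrefl x rewrite ==-refl x = refl

  ⊠-isSimple : IsSimple G → IsSimple H → IsSimple (G ⊠ H)
  ⊠-isSimple sG sH = record { symm = symm ; irrefl = ⊠-irrefl }
    where
    symm : ∀ x y → adj (G ⊠ H) x y ≡ adj (G ⊠ H) y x
    symm x y = cong₂ (λ a b → not a ∧ b) (==-sym x y)
                     (cong₂ _∧_ (adjOrEq-sym sG (⊠-fst x) (⊠-fst y)) (adjOrEq-sym sH (⊠-snd x) (⊠-snd y)))

maximumSubset : ∀ m {p} {P : Subset m → Set p} → Decidable P →
          (∀ S → ¬ P S) ⊎ Σ (Subset m) (λ S → P S × (∀ S′ → P S′ → ∣ S′ ∣ ℕ.≤ ∣ S ∣))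
maximumSubset zero P? with P? []
... | yes P[] = inj₂ ([] , P[] , λ { [] _ → z≤n })
... | no ¬P[] = inj₁ λ { [] → ¬P[] }
maximumSubset (suc m) P? with maximumSubset m (λ S → P? (false ∷ S)) | maximumSubset m (λ S → P? (true ∷ S))
... | inj₁ none₀ | inj₁ none₁ =
  inj₁ λ { (false ∷ S) → none₀ S ; (true ∷ S) → none₁ S }
... | inj₂ (S₀ , P₀ , max₀) | inj₁ none₁ =
  inj₂ (false ∷ S₀ , P₀ , λ { (false ∷ S) PS → max₀ S PS ; (true ∷ S) PS → ⊥-elim (none₁ S PS) })
... | inj₁ none₀ | inj₂ (S₁ , P₁ , max₁) =
  inj₂ (true ∷ S₁ , P₁ , λ { (false ∷ S) PS → ⊥-elim (none₀ S PS) ; (true ∷ S) PS → s≤s (max₁ S PS) })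
... | inj₂ (S₀ , P₀ , max₀) | inj₂ (S₁ , P₁ , max₁) with ℕP.≤-total ∣ S₀ ∣ (suc ∣ S₁ ∣)
...   | inj₁ S₀≤S₁ =
  inj₂ (true ∷ S₁ , P₁ , λ { (false ∷ S) PS → ℕP.≤-trans (max₀ S PS) S₀≤S₁
                           ; (true ∷ S)  PS → s≤s (max₁ S PS) })
...   | inj₂ S₁≤S₀ =
  inj₂ (false ∷ S₀ , P₀ , λ { (false ∷ S) PS → max₀ S PS
                            ; (true ∷ S)  PS → ℕP.≤-trans (s≤s (max₁ S PS)) S₁≤S₀ })

independent? : ∀ G → Decidable (IsIndependent G)
independent? G S = all? λ u → all? λ v →
  (lookup S u ≟ᵇ true) →-dec (lookup S v ≟ᵇ true) →-dec (adj G u v ≟ᵇ false)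

∅-independent : ∀ G → IsIndependent G ∅
∅-independent G u v u∈∅ with () ← trans (sym (lookup-replicate u false)) u∈∅

independenceNumber : ∀ G → ∃ (IsIndepNumber G)
independenceNumber G with maximumSubset (n G) (independent? G)
... | inj₁ none                = ⊥-elim (none ∅ (∅-independent G))
... | inj₂ (S , indep , max) = ∣ S ∣ , (S , indep , refl) , max

⁅⁆-independent : ∀ G {z} → adj G z z ≡ false → IsIndependent G ⁅ z ⁆
⁅⁆-independent G {z} z≁z u v u∈ v∈ =
  subst₂ (λ u v → adj G u v ≡ false) (sym (member u u∈)) (sym (member v v∈)) z≁z
  where
  member : ∀ u → u ∈ₛ ⁅ z ⁆ → u ≡ z
  member u u∈ = x∈⁅y⁆⇒x≡y z (lookup⇒[]= u ⁅ z ⁆ u∈)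

α≥1 : ∀ G → IsSimple G → NonEmpty G → ∀ {k} → IsIndepNumber G k → 1 ℕ.≤ k
α≥1 G sG z (_ , max) =
  subst (ℕ._≤ _) (∣⁅x⁆∣≡1 z) (max ⁅ z ⁆ (⁅⁆-independent G (IsSimple.irrefl sG z)))

-- Counting along a projection

CliqueBounded : (G : Graph) → ℕ → (Fin (n G) → ℕ) → Set
CliqueBounded G N p = ∀ C → IsClique G C → sumOver C p ℕ.≤ N

record Projection (Z G K : Graph) : Set where
  field
    fst      : Fin (n Z) → Fin (n G)
    snd      : Fin (n Z) → Fin (n K)
    adj-lift : ∀ {z z′} → z ≢ z′ → adjOrEq G (fst z) (fst z′) ≡ true →
               adjOrEq K (snd z) (snd z′) ≡ true → adj Z z z′ ≡ true

module _ {Z G K} (π : Projection Z G K) (K-irrefl : ∀ t → adj K t t ≡ false)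
         {Y} (α-K≤Y : ∀ T → IsIndependent K T → ∣ T ∣ ℕ.≤ Y)
         {S} (S-indep : IsIndependent Z S) where
  open Projection π

  fibres-cliqueBounded : CliqueBounded G Y (fibre (lookup S) fst)
  fibres-cliqueBounded C C-clique = begin
    sumOver C (fibre (lookup S) fst) ≡⟨ sum-fibres (lookup S) fst (lookup C) ⟩
    count A                          ≤⟨ count-≤-count-image A snd snd-injective ⟩
    ∣ image A snd ∣                  ≤⟨ α-K≤Y (image A snd) image-independent ⟩
    Y                                ∎
    where
    open ℕP.≤-Reasoning
    A : Fin (n Z) → Bool
    A z = lookup S z ∧ lookup C (fst z)

    -- Points of S over the clique C have adjacent-or-equal G-coordinates, yet are nonadjacent.
    separated : ∀ {z z′} → A z ≡ true → A z′ ≡ true → z ≢ z′ → adjOrEq K (snd z) (snd z′) ≡ false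
    separated {z} {z′} Az Az′ z≢z′ with adjOrEq K (snd z) (snd z′) in close
    ... | false = refl
    ... | true = case trans (sym (adj-lift z≢z′ fst-close close)) nonadjacent of λ ()
      where
      fst-close : adjOrEq G (fst z) (fst z′) ≡ true
      fst-close = clique⇒adjOrEq C C-clique (proj₂ (∧-true⁻ Az)) (proj₂ (∧-true⁻ Az′))
      nonadjacent : adj Z z z′ ≡ false
      nonadjacent = S-indep z z′ (proj₁ (∧-true⁻ Az)) (proj₁ (∧-true⁻ Az′))

    snd-injective : ∀ z z′ → A z ≡ true → A z′ ≡ true → snd z ≡ snd z′ → z ≡ z′
    snd-injective z z′ Az Az′ same with z ≟ z′
    ... | yes z≡z′ = z≡z′
    ... | no  z≢z′ with () ← trans (sym (≡⇒adjOrEq K same)) (separated Az Az′ z≢z′)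

    image-independent : IsIndependent K (image A snd)
    image-independent t t′ t∈ t′∈ with image-sound A snd t∈ | image-sound A snd t′∈
    ... | z , Az , refl | z′ , Az′ , refl with z ≟ z′
    ...   | yes refl = K-irrefl (snd z)
    ...   | no  z≢z′ = ∨-conicalʳ _ _ (separated Az Az′ z≢z′)

K₁ : Graph
K₁ = graph 1 (λ _ _ → false)

self-projection : ∀ G → Projection G G K₁
self-projection G = record
  { fst = λ z → z ; snd = λ _ → zero ; adj-lift = λ z≢z′ close _ → adjOrEq⇒adj G z≢z′ close }

⊠-projection : ∀ G H → Projection (G ⊠ H) G H
⊠-projection G H = record { fst = ⊠-fst G H ; snd = ⊠-snd G H ; adj-lift = ⊠-adj⁺ G H }

⊠-assoc-projection : ∀ G H W → Projection ((G ⊠ H) ⊠ W) G (H ⊠ W)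
⊠-assoc-projection G H W = record { fst = fst ; snd = snd ; adj-lift = adj-lift }
  where
  gh : Fin (n ((G ⊠ H) ⊠ W)) → Fin (n (G ⊠ H))
  gh = ⊠-fst (G ⊠ H) W
  fst : Fin (n ((G ⊠ H) ⊠ W)) → Fin (n G)
  fst z = ⊠-fst G H (gh z)
  snd : Fin (n ((G ⊠ H) ⊠ W)) → Fin (n (H ⊠ W))
  snd z = combine (⊠-snd G H (gh z)) (⊠-snd (G ⊠ H) W z)
  adj-lift : ∀ {z z′} → z ≢ z′ → adjOrEq G (fst z) (fst z′) ≡ true →
             adjOrEq (H ⊠ W) (snd z) (snd z′) ≡ true → adj ((G ⊠ H) ⊠ W) z z′ ≡ true
  adj-lift z≢z′ G-close HW-close with ⊠-adjOrEq-combine⁻ H W HW-close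
  ... | H-close , W-close = ⊠-adj⁺ (G ⊠ H) W z≢z′ (⊠-adjOrEq⁺ G H G-close H-close) W-close

-- Weightings and the blow-up of the complement

clique-image : ∀ {Z G} (φ : Fin (n Z) → Fin (n G)) →
               (∀ {z z′} → adj Z z z′ ≡ true → adjOrEq G (φ z) (φ z′) ≡ true) →
               ∀ {C} → IsClique Z C → IsClique G (image (lookup C) φ)
clique-image {Z} {G} φ φ-close {C} C-clique u v u∈ v∈ u≢v
  with image-sound (lookup C) φ u∈ | image-sound (lookup C) φ v∈
... | z , z∈ , refl | z′ , z′∈ , refl =
  adjOrEq⇒adj G u≢v (φ-close (C-clique z z′ z∈ z′∈ λ { refl → u≢v refl }))

module _ (G H : Graph) (pG : Fin (n G) → ℕ) (pH : Fin (n H) → ℕ) where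
  open import Data.Nat using (_*_; _≤_)

  ⊠-weight : Fin (n (G ⊠ H)) → ℕ
  ⊠-weight z = pG (⊠-fst G H z) * pH (⊠-snd G H z)

  ⊠-weight-combine : ∀ g h → ⊠-weight (combine g h) ≡ pG g * pH h
  ⊠-weight-combine g h = cong₂ _*_ (cong pG (⊠-fst-combine G H g h)) (cong pH (⊠-snd-combine G H g h))

  sum-⊠-weight : sum ⊠-weight ≡ sum pG * sum pH
  sum-⊠-weight = begin
    sum ⊠-weight                                            ≡⟨ sum-combine (n G) (n H) ⊠-weight ⟩
    sum {n G} (λ g → sum {n H} (λ h → ⊠-weight (combine g h)))
      ≡⟨ sum-cong-≗ (λ g → sum-cong-≗ (⊠-weight-combine g)) ⟩
    sum (λ g → sum (λ h → pG g * pH h))                     ≡⟨ sum-cong-≗ (λ g → *-distribˡ-sum (pG g) pH) ⟨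
    sum (λ g → pG g * sum pH)                               ≡⟨ *-distribʳ-sum (sum pH) pG ⟨
    sum pG * sum pH                                         ∎
    where open ≡-Reasoning

  ⊠-cliqueBounded : ∀ {NG NH} → CliqueBounded G NG pG → CliqueBounded H NH pH →
                    CliqueBounded (G ⊠ H) (NG * NH) ⊠-weight
  ⊠-cliqueBounded {NG} {NH} boundedG boundedH C C-clique = begin
    sumOver C ⊠-weight
      ≡⟨ sum-combine (n G) (n H) _ ⟩
    sum {n G} (λ g → sum {n H} (λ h → if lookup C (combine g h) then ⊠-weight (combine g h) else 0))
      ≤⟨ sum-mono (λ g → sum-mono (λ h → pointwise g h)) ⟩
    sum (λ g → sum (λ h → wG g * wH h))        ≡⟨ sum-cong-≗ (λ g → *-distribˡ-sum (wG g) wH) ⟨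
    sum (λ g → wG g * sum wH)                  ≡⟨ *-distribʳ-sum (sum wH) wG ⟨
    sumOver CG pG * sumOver CH pH
      ≤⟨ ℕP.*-mono-≤ (boundedG CG (clique-image (⊠-fst G H) (proj₁ ∘ ⊠-adj⁻ G H) {C} C-clique))
                     (boundedH CH (clique-image (⊠-snd G H) (proj₂ ∘ ⊠-adj⁻ G H) {C} C-clique)) ⟩
    NG * NH ∎
    where
    open ℕP.≤-Reasoning
    CG : Subset (n G)
    CG = image (lookup C) (⊠-fst G H)
    CH : Subset (n H)
    CH = image (lookup C) (⊠-snd G H)
    wG : Fin (n G) → ℕ
    wG g = if lookup CG g then pG g else 0
    wH : Fin (n H) → ℕ
    wH h = if lookup CH h then pH h else 0
    if-* : ∀ {c cG cH} x y → (c ≡ true → cG ≡ true) → (c ≡ true → cH ≡ true) →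
           (if c then x * y else 0) ≤ (if cG then x else 0) * (if cH then y else 0)
    if-* {false} x y _ _ = z≤n
    if-* {true}  x y toG toH rewrite toG refl | toH refl = ℕP.≤-refl
    pointwise : ∀ g h → (if lookup C (combine g h) then ⊠-weight (combine g h) else 0)
                        ≤ wG g * wH h
    pointwise g h rewrite ⊠-weight-combine g h =
      if-* (pG g) (pH h) (λ z∈ → image-complete (lookup C) (⊠-fst G H) z∈ (⊠-fst-combine G H g h))
                         (λ z∈ → image-complete (lookup C) (⊠-snd G H) z∈ (⊠-snd-combine G H g h))

module _ (X : Graph) (p : Fin (n X) → ℕ) where

  coBlowUp : Graph
  coBlowUp = graph (sum p) λ t t′ → not (adjOrEq X (owner p t) (owner p t′))

  coBlowUp-isSimple : IsSimple X → IsSimple coBlowUp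
  coBlowUp-isSimple sX = record
    { symm   = λ t t′ → cong not (adjOrEq-sym sX (owner p t) (owner p t′))
    ; irrefl = λ t → cong not (≡⇒adjOrEq X refl) }

  coBlowUp-adjOrEq⇒≡ : ∀ {t t′} → adjOrEq X (owner p t) (owner p t′) ≡ true →
                        adjOrEq coBlowUp t t′ ≡ true → t ≡ t′
  coBlowUp-adjOrEq⇒≡ {t} {t′} X-close W-close with t ≟ t′
  ... | yes t≡t′ = t≡t′
  ... | no  _    = case trans (sym W-close) (cong not X-close) of λ ()

  coBlowUp-α≤ : ∀ {N} → CliqueBounded X N p → ∀ T → IsIndependent coBlowUp T → ∣ T ∣ ℕ.≤ N
  coBlowUp-α≤ {N} bounded T T-indep = begin
    ∣ T ∣                                       ≡⟨ ∣∣≡count T ⟩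
    count (lookup T)                            ≤⟨ count-≤-image (lookup T) (owner p) p fibre≤p ⟩
    sumOver occupied p                          ≤⟨ bounded occupied occupied-clique ⟩
    N                                           ∎
    where
    open ℕP.≤-Reasoning
    occupied : Subset (n X)
    occupied = image (lookup T) (owner p)
    restrict-≤ : ∀ a b → (if a ∧ b then 1 else 0) ℕ.≤ (if b then 1 else 0)
    restrict-≤ true  b     = ℕP.≤-refl
    restrict-≤ false true  = z≤n
    restrict-≤ false false = z≤n
    fibre≤p : ∀ v → fibre (lookup T) (owner p) v ℕ.≤ p v
    fibre≤p v = ℕP.≤-trans (sum-mono λ t → restrict-≤ (lookup T t) (owner p t == v))
                           (ℕP.≤-reflexive (fibre-owner p v))
    occupied-clique : IsClique X occupied
    occupied-clique u v u∈ v∈ u≢v with image-sound (lookup T) (owner p) u∈ | image-sound (lookup T) (owner p) v∈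
    ... | t , t∈T , refl | t′ , t′∈T , refl = adjOrEq⇒adj X u≢v (not-injective (T-indep t t′ t∈T t′∈T))

  diagonal : Fin (sum p) → Fin (n (X ⊠ coBlowUp))
  diagonal t = combine (owner p t) t

  diagonalSet : Subset (n (X ⊠ coBlowUp))
  diagonalSet = image (λ _ → true) diagonal

  diagonal-independent : IsIndependent (X ⊠ coBlowUp) diagonalSet
  diagonal-independent z z′ z∈ z′∈
    with image-sound (λ _ → true) diagonal z∈ | image-sound (λ _ → true) diagonal z′∈
  ... | t , _ , refl | t′ , _ , refl with adj (X ⊠ coBlowUp) (diagonal t) (diagonal t′) in adjacent
  ...   | false = refl
  ...   | true with ⊠-adjOrEq-combine⁻ X coBlowUp {owner p t} {owner p t′} {t} {t′}
                   (adj⇒adjOrEq (X ⊠ coBlowUp) {diagonal t} {diagonal t′} adjacent)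
  ...     | X-close , W-close with refl ← coBlowUp-adjOrEq⇒≡ {t} {t′} X-close W-close =
    case trans (sym adjacent) (⊠-irrefl X coBlowUp (diagonal t)) of λ ()

  diagonal-size : sum p ℕ.≤ ∣ diagonalSet ∣
  diagonal-size = begin
    sum p                        ≡⟨ count-true (sum p) ⟨
    count {sum p} (λ _ → true)   ≤⟨ count-≤-count-image (λ _ → true) diagonal
                                      (λ t t′ _ _ → combine-injectiveʳ (owner p t) t (owner p t′) t′) ⟩
    ∣ diagonalSet ∣              ∎
    where open ℕP.≤-Reasoning

module _ where
  open import Data.Rational using (_+_; _*_; _≤_; _<_)
  open ℚP.≤-Reasoning

  ℕ→ℚ≡mkℚ : ∀ m → ℕ→ℚ m ≡ mkℚ (ℤ.+ m) 0 (Coprime.sym (Coprime.1-coprimeTo m))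
  ℕ→ℚ≡mkℚ m = ℚP.normalize-coprime (Coprime.sym (Coprime.1-coprimeTo m))

  ℕ→ℚ-+ : ∀ m k → ℕ→ℚ (m ℕ.+ k) ≡ ℕ→ℚ m + ℕ→ℚ k
  ℕ→ℚ-+ m k = sym (trans (cong₂ _+_ (ℕ→ℚ≡mkℚ m) (ℕ→ℚ≡mkℚ k)) (ℚP./-cong numerator refl))
    where
    numerator : ℤ.+ m ℤ.* ℤ.+ 1 ℤ.+ ℤ.+ k ℤ.* ℤ.+ 1 ≡ ℤ.+ (m ℕ.+ k)
    numerator rewrite ℤP.*-identityʳ (ℤ.+ m) | ℤP.*-identityʳ (ℤ.+ k) = refl

  ℕ→ℚ-* : ∀ m k → ℕ→ℚ (m ℕ.* k) ≡ ℕ→ℚ m * ℕ→ℚ k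
  ℕ→ℚ-* m k = sym (trans (cong₂ _*_ (ℕ→ℚ≡mkℚ m) (ℕ→ℚ≡mkℚ k)) (ℚP./-cong (sym (ℤP.pos-* m k)) refl))

  ℕ→ℚ-mono-≤ : ∀ {m k} → m ℕ.≤ k → ℕ→ℚ m ≤ ℕ→ℚ k
  ℕ→ℚ-mono-≤ {m} {k} m≤k rewrite ℕ→ℚ≡mkℚ m | ℕ→ℚ≡mkℚ k =
    *≤* (subst₂ ℤ._≤_ (sym (ℤP.*-identityʳ (ℤ.+ m))) (sym (ℤP.*-identityʳ (ℤ.+ k))) (ℤ.+≤+ m≤k))

  ℕ→ℚ-cancel-≤ : ∀ {m k} → ℕ→ℚ m ≤ ℕ→ℚ k → m ℕ.≤ k
  ℕ→ℚ-cancel-≤ {m} {k} m≤k rewrite ℕ→ℚ≡mkℚ m | ℕ→ℚ≡mkℚ k with m≤k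
  ... | *≤* m≤k′ with subst₂ ℤ._≤_ (ℤP.*-identityʳ (ℤ.+ m)) (ℤP.*-identityʳ (ℤ.+ k)) m≤k′
  ...   | ℤ.+≤+ m≤k″ = m≤k″

  ℕ→ℚ-cancel-< : ∀ {m k} → ℕ→ℚ m < ℕ→ℚ k → m ℕ.< k
  ℕ→ℚ-cancel-< {m} {k} m<k rewrite ℕ→ℚ≡mkℚ m | ℕ→ℚ≡mkℚ k with m<k
  ... | *<* m<k′ with subst₂ ℤ._<_ (ℤP.*-identityʳ (ℤ.+ m)) (ℤP.*-identityʳ (ℤ.+ k)) m<k′
  ...   | ℤ.+<+ m<k″ = m<k″

  ℕ→ℚ-nonNeg : ∀ m → 0ℚ ≤ ℕ→ℚ m
  ℕ→ℚ-nonNeg m = ℕ→ℚ-mono-≤ {0} {m} z≤n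

  ℕ→ℚ-pos : ∀ m → 0ℚ < ℕ→ℚ (suc m)
  ℕ→ℚ-pos m = ℚP.<-≤-trans (ℚP.positive⁻¹ 1ℚ) (ℕ→ℚ-mono-≤ {1} {suc m} (s≤s z≤n))

  ∑-scaled : ∀ {m} (p : Fin m → ℕ) (w : Fin m → ℚ) c → (∀ v → ℕ→ℚ (p v) ≡ w v * c) →
             ℕ→ℚ (sum p) ≡ ∑ w * c
  ∑-scaled {zero}  p w c _      = sym (ℚP.*-zeroˡ c)
  ∑-scaled {suc m} p w c scaled = begin-equality
    ℕ→ℚ (p zero ℕ.+ sum (λ i → p (suc i)))        ≡⟨ ℕ→ℚ-+ (p zero) _ ⟩
    ℕ→ℚ (p zero) + ℕ→ℚ (sum (λ i → p (suc i)))
      ≡⟨ cong₂ _+_ (scaled zero) (∑-scaled _ _ c (λ i → scaled (suc i))) ⟩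
    w zero * c + ∑ (λ i → w (suc i)) * c           ≡⟨ ℚP.*-distribʳ-+ c (w zero) _ ⟨
    ∑ w * c                                        ∎

  ∑over-scaled : ∀ {m} (C : Subset m) (p : Fin m → ℕ) (w : Fin m → ℚ) c →
                 (∀ v → ℕ→ℚ (p v) ≡ w v * c) → ℕ→ℚ (sumOver C p) ≡ ∑over C w * c
  ∑over-scaled C p w c scaled = ∑-scaled _ _ c restricted
    where
    restricted : ∀ v → ℕ→ℚ (if lookup C v then p v else 0) ≡ (if lookup C v then w v else 0ℚ) * c
    restricted v with lookup C v
    ... | true  = scaled v
    ... | false = sym (ℚP.*-zeroˡ c)

  clearDenominator : ∀ x → 0ℚ ≤ x → Σ ℕ λ k → Σ ℕ λ d → ℕ→ℚ k ≡ x * ℕ→ℚ (suc d)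
  clearDenominator x@(mkℚ (ℤ.+ k) d _) _ =
    k , d , sym (ℚP.toℚᵘ-injective (ℚᵘP.≃-trans (ℚP.toℚᵘ-homo-* x (ℕ→ℚ (suc d))) cleared))
    where
    cleared : toℚᵘ x ℚᵘ.* toℚᵘ (ℕ→ℚ (suc d)) ℚᵘ.≃ toℚᵘ (ℕ→ℚ k)
    cleared rewrite ℕ→ℚ≡mkℚ (suc d) | ℕ→ℚ≡mkℚ k = ℚᵘ.*≡* cross
      where
      cross : (ℤ.+ k ℤ.* ℤ.+ suc d) ℤ.* ℤ.+ 1 ≡ ℤ.+ k ℤ.* ℤ.+ suc (d ℕ.* 1)
      cross rewrite ℤP.*-identityʳ (ℤ.+ k ℤ.* ℤ.+ suc d) | ℕP.*-identityʳ d = refl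
  clearDenominator (mkℚ ℤ.-[1+ _ ] _ _) (*≤* ())

  commonDenominator : ∀ {m} (w : Fin m → ℚ) → (∀ v → 0ℚ ≤ w v) →
                      Σ ℕ λ D → Σ (Fin m → ℕ) λ p → ∀ v → ℕ→ℚ (p v) ≡ w v * ℕ→ℚ (suc D)
  commonDenominator {zero}  w _   = 0 , (λ ()) , λ ()
  commonDenominator {suc m} w w≥0
    with clearDenominator (w zero) (w≥0 zero) | commonDenominator (λ i → w (suc i)) (λ i → w≥0 (suc i))
  -- suc (d + D′ * suc d) computes to suc D′ * suc d, the product of the denominators
  ... | k , d , k≡w₀d | D′ , p′ , scaled′ = d ℕ.+ D′ ℕ.* suc d , p , scaled
    where
    p : Fin (suc m) → ℕ
    p zero    = k ℕ.* suc D′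
    p (suc v) = p′ v ℕ.* suc d
    scaled : ∀ v → ℕ→ℚ (p v) ≡ w v * ℕ→ℚ (suc D′ ℕ.* suc d)
    scaled zero = begin-equality
      ℕ→ℚ (k ℕ.* suc D′)                              ≡⟨ ℕ→ℚ-* k (suc D′) ⟩
      ℕ→ℚ k * ℕ→ℚ (suc D′)                            ≡⟨ cong (_* ℕ→ℚ (suc D′)) k≡w₀d ⟩
      w zero * ℕ→ℚ (suc d) * ℕ→ℚ (suc D′)            ≡⟨ ℚP.*-assoc (w zero) _ _ ⟩
      w zero * (ℕ→ℚ (suc d) * ℕ→ℚ (suc D′))          ≡⟨ cong (w zero *_) (ℚP.*-comm (ℕ→ℚ (suc d)) _) ⟩
      w zero * (ℕ→ℚ (suc D′) * ℕ→ℚ (suc d))          ≡⟨ cong (w zero *_) (ℕ→ℚ-* (suc D′) (suc d)) ⟨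
      w zero * ℕ→ℚ (suc D′ ℕ.* suc d)                 ∎
    scaled (suc v) = begin-equality
      ℕ→ℚ (p′ v ℕ.* suc d)                            ≡⟨ ℕ→ℚ-* (p′ v) (suc d) ⟩
      ℕ→ℚ (p′ v) * ℕ→ℚ (suc d)                        ≡⟨ cong (_* ℕ→ℚ (suc d)) (scaled′ v) ⟩
      w (suc v) * ℕ→ℚ (suc D′) * ℕ→ℚ (suc d)         ≡⟨ ℚP.*-assoc (w (suc v)) _ _ ⟩
      w (suc v) * (ℕ→ℚ (suc D′) * ℕ→ℚ (suc d))       ≡⟨ cong (w (suc v) *_) (ℕ→ℚ-* (suc D′) (suc d)) ⟨
      w (suc v) * ℕ→ℚ (suc D′ ℕ.* suc d)              ∎

  cliqueBounded⇒≤α* : ∀ {G a D p} → IsFracIndepNumber G a → CliqueBounded G (suc D) p →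
                      ℕ→ℚ (sum p) ≤ a * ℕ→ℚ (suc D)
  cliqueBounded⇒≤α* {G} {a} {D} {p} (_ , optimal) bounded = begin
    ℕ→ℚ (sum p) ≡⟨ ∑-scaled p w c scaled ⟩
    ∑ w * c      ≤⟨ ℚP.*-monoʳ-≤-nonNeg c (optimal w (w-nonNeg , w-clique)) ⟩
    a * c        ∎
    where
    c : ℚ
    c = ℕ→ℚ (suc D)
    instance
      c-positive : Positive c
      c-positive = positive (ℕ→ℚ-pos D)
      c-nonZero : NonZero c
      c-nonZero = ℚP.pos⇒nonZero c
      c-nonNegative : NonNegative c
      c-nonNegative = ℚP.pos⇒nonNeg c
    w : Fin (n G) → ℚ
    w v = ℕ→ℚ (p v) * 1/ c
    scaled : ∀ v → ℕ→ℚ (p v) ≡ w v * c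
    scaled v = sym (begin-equality
      ℕ→ℚ (p v) * 1/ c * c     ≡⟨ ℚP.*-assoc (ℕ→ℚ (p v)) (1/ c) c ⟩
      ℕ→ℚ (p v) * (1/ c * c)   ≡⟨ cong (ℕ→ℚ (p v) *_) (ℚP.*-inverseˡ c) ⟩
      ℕ→ℚ (p v) * 1ℚ           ≡⟨ ℚP.*-identityʳ (ℕ→ℚ (p v)) ⟩
      ℕ→ℚ (p v)                ∎)
    w-nonNeg : ∀ v → 0ℚ ≤ w v
    w-nonNeg v = ℚP.*-cancelʳ-≤-pos c (begin
      0ℚ * c      ≡⟨ ℚP.*-zeroˡ c ⟩
      0ℚ          ≤⟨ ℕ→ℚ-nonNeg (p v) ⟩
      ℕ→ℚ (p v)  ≡⟨ scaled v ⟩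
      w v * c     ∎)
    w-clique : ∀ C → IsClique G C → ∑over C w ≤ 1ℚ
    w-clique C C-clique = ℚP.*-cancelʳ-≤-pos c (begin
      ∑over C w * c         ≡⟨ ∑over-scaled C p w c scaled ⟨
      ℕ→ℚ (sumOver C p)     ≤⟨ ℕ→ℚ-mono-≤ (bounded C C-clique) ⟩
      c                     ≡⟨ ℚP.*-identityˡ c ⟨
      1ℚ * c                ∎)

  record ClearedOptimum (G : Graph) (a : ℚ) : Set where
    field
      D       : ℕ
      p       : Fin (n G) → ℕ
      bounded : CliqueBounded G (suc D) p
      total   : ℕ→ℚ (sum p) ≡ a * ℕ→ℚ (suc D)

  clearedOptimum : ∀ {G a} → IsFracIndepNumber G a → ClearedOptimum G a
  clearedOptimum ((w , (w-nonNeg , w-clique) , ∑w≡a) , _) with commonDenominator w w-nonNeg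
  ... | D , p , scaled = record
    { D = D ; p = p ; bounded = bounded ; total = trans (∑-scaled p w c scaled) (cong (_* c) ∑w≡a) }
    where
    c : ℚ
    c = ℕ→ℚ (suc D)
    bounded : ∀ C → IsClique _ C → sumOver C p ℕ.≤ suc D
    bounded C C-clique = ℕ→ℚ-cancel-≤ (begin
      ℕ→ℚ (sumOver C p)   ≡⟨ ∑over-scaled C p w c scaled ⟩
      ∑over C w * c        ≤⟨ ℚP.*-monoʳ-≤-nonNeg c {{nonNegative (ℕ→ℚ-nonNeg (suc D))}}
                                                  (w-clique C C-clique) ⟩
      1ℚ * c               ≡⟨ ℚP.*-identityˡ c ⟩
      c                    ∎)

  α≤α*·α : ∀ {Z G K a Y} → Projection Z G K → (∀ t → adj K t t ≡ false) → IsFracIndepNumber G a →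
           (∀ T → IsIndependent K T → ∣ T ∣ ℕ.≤ suc Y) →
           ∀ {S} → IsIndependent Z S → ℕ→ℚ ∣ S ∣ ≤ a * ℕ→ℚ (suc Y)
  α≤α*·α {a = a} {Y} π K-irrefl α*G α-K {S} S-indep =
    subst (λ k → ℕ→ℚ k ≤ a * ℕ→ℚ (suc Y)) (trans (sum-fibre (lookup S) fst) (sym (∣∣≡count S)))
      (cliqueBounded⇒≤α* α*G (fibres-cliqueBounded π K-irrefl α-K {S} S-indep))
    where open Projection π

  indepNumber≤α*·α : ∀ {Z G K a Y x} → Projection Z G K → (∀ t → adj K t t ≡ false) →
                     IsFracIndepNumber G a → (∀ T → IsIndependent K T → ∣ T ∣ ℕ.≤ suc Y) →
                     IsIndepNumber Z x → ℕ→ℚ x ≤ a * ℕ→ℚ (suc Y)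
  indepNumber≤α*·α {a = a} {Y} π K-irrefl α*G α-K ((S , S-indep , ∣S∣≡x) , _) =
    subst (λ k → ℕ→ℚ k ≤ a * ℕ→ℚ (suc Y)) ∣S∣≡x (α≤α*·α π K-irrefl α*G α-K {S} S-indep)

  α*≥1 : ∀ {G a} → IsSimple G → NonEmpty G → IsFracIndepNumber G a → 1ℚ ≤ a
  α*≥1 {G} {a} sG z α*G = begin
    1ℚ               ≡⟨ cong ℕ→ℚ (∣⁅x⁆∣≡1 z) ⟨
    ℕ→ℚ ∣ ⁅ z ⁆ ∣    ≤⟨ α≤α*·α (self-projection G) (λ _ → refl) α*G (λ T _ → ∣p∣≤n T) {⁅ z ⁆}
                           (⁅⁆-independent G (IsSimple.irrefl sG z)) ⟩
    a * 1ℚ           ≡⟨ ℚP.*-identityʳ a ⟩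
    a                ∎

  α*-pos : ∀ {G a} → IsSimple G → NonEmpty G → IsFracIndepNumber G a → 0ℚ < a
  α*-pos sG z α*G = ℚP.<-≤-trans (ℚP.positive⁻¹ 1ℚ) (α*≥1 sG z α*G)

  *-nonNeg : ∀ {x y} → 0ℚ ≤ x → 0ℚ ≤ y → 0ℚ ≤ x * y
  *-nonNeg {x} {y} x≥0 y≥0 =
    ℚP.nonNegative⁻¹ (x * y) {{ℚP.nonNeg*nonNeg⇒nonNeg x {{nonNegative x≥0}} y {{nonNegative y≥0}}}}

  -- Relative fractional independence numbers

  RatioExceeds : Graph → Graph → ℚ → Set
  RatioExceeds X H q = Σ Graph λ W → IsSimple W × NonEmpty W × Σ ℕ λ x → Σ ℕ λ y →
    IsIndepNumber (X ⊠ W) x × IsIndepNumber (H ⊠ W) y × q * ℕ→ℚ y < ℕ→ℚ x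

  RatioExceeds-antitone : ∀ {X H q q′} → q ≤ q′ → RatioExceeds X H q′ → RatioExceeds X H q
  RatioExceeds-antitone q≤q′ (W , sW , w , x , y , αx , αy , q′y<x) =
    W , sW , w , x , y , αx , αy ,
    ℚP.≤-<-trans (ℚP.*-monoʳ-≤-nonNeg (ℕ→ℚ y) {{nonNegative (ℕ→ℚ-nonNeg y)}} q≤q′) q′y<x

  RatioExceeds-fromNonNeg : ∀ {X H} (P : ℚ → Set) → P 0ℚ →
                            (∀ q → 0ℚ ≤ q → P q → RatioExceeds X H q) → ∀ q → P q → RatioExceeds X H q
  RatioExceeds-fromNonNeg {X} {H} P P0 nonNeg q Pq with 0ℚ ℚP.≤? q
  ... | yes q≥0 = nonNeg q q≥0 Pq
  ... | no  q≱0 = RatioExceeds-antitone {X} {H} (ℚP.<⇒≤ (ℚP.≰⇒> q≱0)) (nonNeg 0ℚ ℚP.≤-refl P0)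

  coBlowUp-RatioExceeds : ∀ {X H b D p} → IsSimple X → IsSimple H → NonEmpty H → IsFracIndepNumber H b →
                   CliqueBounded X (suc D) p → ∀ q → 0ℚ ≤ q →
                   q * b * ℕ→ℚ (suc D) < ℕ→ℚ (sum p) → RatioExceeds X H q
  coBlowUp-RatioExceeds {X} {H} {b} {D} {p} sX sH h α*H bounded q q≥0 qbc<P
    with independenceNumber (X ⊠ coBlowUp X p) | independenceNumber (H ⊠ coBlowUp X p)
  ... | x , αx | y , αy = coBlowUp X p , sW , fromℕ< 0<P , x , y , αx , αy , qy<x
    where
    sW : IsSimple (coBlowUp X p)
    sW = coBlowUp-isSimple X p sX
    c : ℚ
    c = ℕ→ℚ (suc D)
    0<P : 0 ℕ.< sum p
    0<P = ℕ→ℚ-cancel-< (ℚP.≤-<-trans 0≤qbc qbc<P)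
      where
      0≤qbc : 0ℚ ≤ q * b * c
      0≤qbc = *-nonNeg (*-nonNeg q≥0 (ℚP.<⇒≤ (α*-pos sH h α*H))) (ℕ→ℚ-nonNeg (suc D))
    y≤bc : ℕ→ℚ y ≤ b * c
    y≤bc = indepNumber≤α*·α (⊠-projection H (coBlowUp X p)) (IsSimple.irrefl sW) α*H
                            (coBlowUp-α≤ X p bounded) αy
    P≤x : sum p ℕ.≤ x
    P≤x = ℕP.≤-trans (diagonal-size X p) (proj₂ αx (diagonalSet X p) (diagonal-independent X p))
    qy<x : q * ℕ→ℚ y < ℕ→ℚ x
    qy<x = begin-strict
      q * ℕ→ℚ y     ≤⟨ ℚP.*-monoˡ-≤-nonNeg q {{nonNegative q≥0}} y≤bc ⟩
      q * (b * c)   ≡⟨ ℚP.*-assoc q b c ⟨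
      q * b * c     <⟨ qbc<P ⟩
      ℕ→ℚ (sum p)   ≤⟨ ℕ→ℚ-mono-≤ P≤x ⟩
      ℕ→ℚ x         ∎

  relative-≥-α*/α* : ∀ {G H a b} → IsSimple G → IsSimple H → NonEmpty G → NonEmpty H →
                   IsFracIndepNumber G a → IsFracIndepNumber H b →
                   ∀ q → q * b < a → RatioExceeds G H q
  relative-≥-α*/α* {G} {H} {a} {b} sG sH g h α*G α*H =
    RatioExceeds-fromNonNeg {G} {H} (λ q → q * b < a) 0b<a nonNeg
    where
    0b<a : 0ℚ * b < a
    0b<a = subst (_< a) (sym (ℚP.*-zeroˡ b)) (α*-pos sG g α*G)
    nonNeg : ∀ q → 0ℚ ≤ q → q * b < a → RatioExceeds G H q
    nonNeg q q≥0 qb<a = coBlowUp-RatioExceeds {G} {H} {b} {D} {p} sG sH h α*H bounded q q≥0 (begin-strict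
      q * b * c      <⟨ ℚP.*-monoˡ-<-pos c {{positive (ℕ→ℚ-pos D)}} qb<a ⟩
      a * c          ≡⟨ total ⟨
      ℕ→ℚ (sum p)    ∎)
      where
      open ClearedOptimum (clearedOptimum α*G)
      c : ℚ
      c = ℕ→ℚ (suc D)

  relative-⊠-≤-α* : ∀ {G H a} → IsSimple H → NonEmpty H → IsFracIndepNumber G a →
                  ∀ W → IsSimple W → NonEmpty W → ∀ x y →
                  IsIndepNumber ((G ⊠ H) ⊠ W) x → IsIndepNumber (H ⊠ W) y → ℕ→ℚ x ≤ a * ℕ→ℚ y
  relative-⊠-≤-α* {G} {H} sH h α*G W sW w x y αx αy
    with y | α≥1 (H ⊠ W) (⊠-isSimple H W sH sW) (combine h w) αy | αy
  ... | suc Y | _ | _ , maximal = indepNumber≤α*·α (⊠-assoc-projection G H W) (⊠-irrefl H W) α*G maximal αx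

  relative-⊠-≥-α* : ∀ {G H a b} → IsSimple G → IsSimple H → NonEmpty G → NonEmpty H →
                  IsFracIndepNumber G a → IsFracIndepNumber H b →
                  ∀ q → q < a → RatioExceeds (G ⊠ H) H q
  relative-⊠-≥-α* {G} {H} {a} {b} sG sH g h α*G α*H =
    RatioExceeds-fromNonNeg {G ⊠ H} {H} (_< a) (α*-pos sG g α*G) nonNeg
    where
    nonNeg : ∀ q → 0ℚ ≤ q → q < a → RatioExceeds (G ⊠ H) H q
    nonNeg q q≥0 q<a =
      -- suc (OH.D + OG.D * suc OH.D) computes to suc OG.D * suc OH.D
      coBlowUp-RatioExceeds {G ⊠ H} {H} {b} {OH.D ℕ.+ OG.D ℕ.* suc OH.D} {⊠-weight G H OG.p OH.p}
                     (⊠-isSimple G H sG sH) sH h α*H (⊠-cliqueBounded G H OG.p OH.p OG.bounded OH.bounded)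
                     q q≥0 (begin-strict
        q * b * ℕ→ℚ (suc OG.D ℕ.* suc OH.D)               ≡⟨ cong (q * b *_) (ℕ→ℚ-* (suc OG.D) (suc OH.D)) ⟩
        q * b * (cG * cH)                                  ≡⟨ ℚP.*-assoc q b (cG * cH) ⟩
        q * (b * (cG * cH))                                <⟨ ℚP.*-monoˡ-<-pos (b * (cG * cH)) {{bcc-pos}} q<a ⟩
        a * (b * (cG * cH))                                ≡⟨ rearrange a b cG cH ⟩
        (a * cG) * (b * cH)                                ≡⟨ cong₂ _*_ OG.total OH.total ⟨
        ℕ→ℚ (sum OG.p) * ℕ→ℚ (sum OH.p)                    ≡⟨ ℕ→ℚ-* (sum OG.p) (sum OH.p) ⟨
        ℕ→ℚ (sum OG.p ℕ.* sum OH.p)                        ≡⟨ cong ℕ→ℚ (sum-⊠-weight G H OG.p OH.p) ⟨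
        ℕ→ℚ (sum (⊠-weight G H OG.p OH.p))                 ∎)
      where
      module OG = ClearedOptimum (clearedOptimum α*G)
      module OH = ClearedOptimum (clearedOptimum α*H)
      cG cH : ℚ
      cG = ℕ→ℚ (suc OG.D)
      cH = ℕ→ℚ (suc OH.D)
      instance
        b-pos : Positive b
        b-pos = positive (α*-pos sH h α*H)
        cG-pos : Positive cG
        cG-pos = positive (ℕ→ℚ-pos OG.D)
        cH-pos : Positive cH
        cH-pos = positive (ℕ→ℚ-pos OH.D)
      bcc-pos : Positive (b * (cG * cH))
      bcc-pos = ℚP.pos*pos⇒pos b (cG * cH) {{ℚP.pos*pos⇒pos cG cH}}
      rearrange : ∀ a b c d → a * (b * (c * d)) ≡ (a * c) * (b * d)
      rearrange = solve 4 (λ a b c d → a ⊕ (b ⊕ (c ⊕ d)) ⊜ (a ⊕ c) ⊕ (b ⊕ d)) refl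

  corollary1 : (G H : Graph) → IsSimple G → IsSimple H → NonEmpty G → NonEmpty H →
    (a b : ℚ) → IsFracIndepNumber G a → IsFracIndepNumber H b →
    -- α*(G|H) ≥ α*(G)/α*(H): every q < a/b is exceeded by some ratio
    ((q : ℚ) → q * b < a →
      Σ Graph (λ W → IsSimple W × NonEmpty W × Σ ℕ (λ x → Σ ℕ (λ y →
        IsIndepNumber (G ⊠ W) x × IsIndepNumber (H ⊠ W) y × q * ℕ→ℚ y < ℕ→ℚ x))))
    ×
    -- α*(G⊠H|H) ≤ α*(G): every ratio is at most a
    ((W : Graph) → IsSimple W → NonEmpty W → (x y : ℕ) →
      IsIndepNumber ((G ⊠ H) ⊠ W) x → IsIndepNumber (H ⊠ W) y → ℕ→ℚ x ≤ a * ℕ→ℚ y)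
    ×
    -- α*(G⊠H|H) ≥ α*(G): every q < a is exceeded by some ratio
    ((q : ℚ) → q < a →
      Σ Graph (λ W → IsSimple W × NonEmpty W × Σ ℕ (λ x → Σ ℕ (λ y →
        IsIndepNumber ((G ⊠ H) ⊠ W) x × IsIndepNumber (H ⊠ W) y × q * ℕ→ℚ y < ℕ→ℚ x))))
  corollary1 G H sG sH g h a b α*G α*H =
    relative-≥-α*/α* sG sH g h α*G α*H ,
    relative-⊠-≤-α* sH h α*G ,
    relative-⊠-≥-α* sG sH g h α*G α*H
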